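{- Let $\pi\in\mathcal{S}_n$ and let $w_1\cdots w_{n-1}$ be a word over $\mathbb{N}$ such that $w_j-w_i\ge z_j-z_i$ for all $1\le i,j<n$ with $\pi(j)>\pi(i)$. Let $1\le i<j<n$. If $\pi(i)<\pi(j)$, then $w_{[i,i+n-j)}\le w_{[j,n)}$, and in case of equality $(-1)^{n-j}\pi(i+n-j)<(-1)^{n-j}\pi(n)$. If $\pi(i)>\pi(j)$, then $w_{[i,i+n-j)}\ge w_{[j,n)}$, and in case of equality $(-1)^{n-j}\pi(i+n-j)>(-1)^{n-j}\pi(n)$.
   Context: $\mathbb{N}=\{0,1,2,\dots\}$; $w_{[i,j)}=w_i\cdots w_{j-1}$. Words of equal length are compared in the alternating lexicographical order: $v<w$ if for some $k$, $v_1\cdots v_{k-1}=w_1\cdots w_{k-1}$ and $v_k<w_k$ for odd $k$, $w_k<v_k$ for even $k$. For $\pi\in\mathcal{S}_n$: $\ell=\pi^{ -1}(\pi(n)-1)$ if $\pi(n)\ne1$; $r=\pi^{ -1}(\pi(n)+1)$ if $\pi(n)\ne n$; for $1\le j<n$, $z_j=\#\{1\le i<\pi(j):\ (i\ne\pi(n)\ne i+1$ and $\pi(\pi^{ -1}(i)+1)<\pi(\pi^{ -1}(i+1)+1))$ or $(i+1=\pi(n)\ne n$ and $\pi(\ell+1)<\pi(r+1))\}$. -}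

module Defs where

open import Data.Nat using (ℕ; zero; suc; _+_; _∸_; _<_; _≤?_; _<?_)
open import Data.Nat.Properties using (_≟_)
open import Data.Fin using (Fin; toℕ; fromℕ<)
open import Data.Fin.Permutation using (Permutation′; _⟨$⟩ʳ_; _⟨$⟩ˡ_)
open import Data.List using (List; []; _∷_; applyUpTo; filter; length; upTo)
open import Data.Empty using (⊥)
open import Data.Product using (_×_)
open import Data.Sum using (_⊎_)
open import Relation.Nullary using (Dec; yes; no; ¬_)
open import Relation.Nullary.Decidable using (_×-dec_; _⊎-dec_; ¬?)
open import Relation.Binary.PropositionalEquality using (_≡_)

-- π ∈ S_n viewed as a map on {1,…,n} (1-indexed); value 0 outside {1,…,n}.
perm : {n : ℕ} → Permutation′ n → ℕ → ℕ
perm {n} π zero = 0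
perm {n} π (suc k) with suc k ≤? n
... | yes k<n = suc (toℕ (π ⟨$⟩ʳ fromℕ< k<n))
... | no _ = 0

permInv : {n : ℕ} → Permutation′ n → ℕ → ℕ
permInv {n} π zero = 0
permInv {n} π (suc k) with suc k ≤? n
... | yes k<n = suc (toℕ (π ⟨$⟩ˡ fromℕ< k<n))
... | no _ = 0

-- ℓ = π⁻¹(π(n) − 1), r = π⁻¹(π(n) + 1)  (only used where defined)
ℓ-of : {n : ℕ} → Permutation′ n → ℕ
ℓ-of {n} π = permInv π (perm π n ∸ 1)

r-of : {n : ℕ} → Permutation′ n → ℕ
r-of {n} π = permInv π (perm π n + 1)

zCond : {n : ℕ} → Permutation′ n → ℕ → Set
zCond {n} π i =
  ((¬ (i ≡ perm π n) × ¬ (perm π n ≡ i + 1))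
     × perm π (permInv π i + 1) < perm π (permInv π (i + 1) + 1))
  ⊎ ((i + 1 ≡ perm π n × ¬ (perm π n ≡ n))
     × perm π (ℓ-of π + 1) < perm π (r-of π + 1))

zCond? : {n : ℕ} (π : Permutation′ n) (i : ℕ) → Dec (zCond π i)
zCond? {n} π i =
  (((¬? (i ≟ perm π n)) ×-dec (¬? (perm π n ≟ i + 1)))
     ×-dec (perm π (permInv π i + 1) <? perm π (permInv π (i + 1) + 1)))
  ⊎-dec (((i + 1 ≟ perm π n) ×-dec (¬? (perm π n ≟ n)))
     ×-dec (perm π (ℓ-of π + 1) <? perm π (r-of π + 1)))

z : {n : ℕ} → Permutation′ n → ℕ → ℕ
z π j = length (filter (zCond? π) (applyUpTo (λ t → suc t) (perm π j ∸ 1)))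

factor : (ℕ → ℕ) → ℕ → ℕ → List ℕ
factor w i k = applyUpTo (λ t → w (i + t)) (k ∸ i)

-- alternating lexicographic strict order: position 1 is odd.
mutual
  altLtOdd : List ℕ → List ℕ → Set
  altLtOdd [] _ = ⊥
  altLtOdd (_ ∷ _) [] = ⊥
  altLtOdd (a ∷ v) (b ∷ w) = (a < b) ⊎ (a ≡ b × altLtEven v w)

  altLtEven : List ℕ → List ℕ → Set
  altLtEven [] _ = ⊥
  altLtEven (_ ∷ _) [] = ⊥
  altLtEven (a ∷ v) (b ∷ w) = (b < a) ⊎ (a ≡ b × altLtOdd v w)

_<alt_ : List ℕ → List ℕ → Set
v <alt w = altLtOdd v w

_≤alt_ : List ℕ → List ℕ → Set
v ≤alt w = v <alt w ⊎ v ≡ w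

module Submission where

-- If π(a) < π(b) and the letters w_a, w_b tie, the
-- slack hypothesis forces z_a = z_b, so no value in [π(a), π(b)) is counted by z. Unfolding z,
-- this says that k ↦ π(π⁻¹(k) + 1) does not increase on [π(a), π(b)], hence π(b+1) < π(a+1):
-- the comparison continues at the next positions with the roles swapped, exactly as the
-- alternating order does, until the suffix ends at n and π(i+n−j) is compared with π(n).

open import Defs
open import Data.Nat using (ℕ; zero; suc; _+_; _∸_; _≤_; _<_; _≤′_; ≤′-refl; ≤′-step; z≤n; s≤s; _<?_)
open import Data.Nat.Properties
open import Data.Fin using (toℕ; fromℕ<)
open import Data.Fin.Properties using (toℕ<n; fromℕ<-toℕ; toℕ-fromℕ<)
open import Data.Fin.Permutation using (Permutation′; _⟨$⟩ʳ_; _⟨$⟩ˡ_; inverseˡ)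
open import Data.List using (List; []; _∷_; [_]; _++_; applyUpTo; filter; length)
open import Data.List.Properties using (applyUpTo-∷ʳ; filter-++; filter-accept; length-++)
open import Data.Product using (_×_; _,_; map₂)
open import Data.Sum using (_⊎_; inj₁; inj₂)
open import Function using (_∘_)
open import Level using (Level)
open import Relation.Binary using (tri<; tri≈; tri>)
open import Relation.Binary.PropositionalEquality hiding ([_])
open import Relation.Nullary using (¬_; Dec; yes; no; contradiction)
open import Relation.Unary using (Pred; Decidable)
open import Data.Integer using (+_; -_; _-_; _*_; _^_; +<+; +≤+) renaming (_≤_ to _≤ℤ_; _<_ to _<ℤ_)
import Data.Integer.Properties as ℤ

gap-≤ : ∀ {a b c d} → b ≤ a → + a - + b ≤ℤ + c - + d → d ≤ c
gap-≤ b≤a gap = ℤ.drop‿+≤+ (ℤ.0≤i-j⇒j≤i (ℤ.≤-trans (ℤ.i≤j⇒0≤j-i (+≤+ b≤a)) gap))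

gap-< : ∀ {a b c d} → b < a → + a - + b ≤ℤ + c - + d → d < c
gap-< b<a gap = ≰⇒> λ c≤d →
  <⇒≱ b<a (ℤ.drop‿+≤+ (ℤ.i-j≤0⇒i≤j (ℤ.≤-trans gap (ℤ.i≤j⇒i-j≤0 (+≤+ c≤d)))))

-- SignedLt d x y  is  (-1)^d x < (-1)^d y, kept inside ℕ.
SignedLt : ℕ → ℕ → ℕ → Set
SignedLt zero    x y = x < y
SignedLt (suc d) x y = SignedLt d y x

SignedLt⇒<ℤ : ∀ d {x y} → SignedLt d x y → (- + 1) ^ d * + x <ℤ (- + 1) ^ d * + y
SignedLt⇒<ℤ zero {x} {y} x<y =
  subst₂ _<ℤ_ (sym (ℤ.*-identityˡ (+ x))) (sym (ℤ.*-identityˡ (+ y))) (+<+ x<y)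
SignedLt⇒<ℤ (suc d) {x} {y} y<x =
  subst₂ _<ℤ_ (sym (negate x)) (sym (negate y)) (ℤ.neg-mono-< (SignedLt⇒<ℤ d y<x))
  where
    negate : ∀ v → (- + 1) ^ suc d * + v ≡ - ((- + 1) ^ d * + v)
    negate v = trans (ℤ.*-assoc (- + 1) ((- + 1) ^ d) (+ v)) (ℤ.-1*i≡-i ((- + 1) ^ d * + v))

mutual
  altLtOdd-flip : ∀ u v → altLtOdd u v → altLtEven v u
  altLtOdd-flip (a ∷ u) (b ∷ v) (inj₁ a<b)           = inj₁ a<b
  altLtOdd-flip (a ∷ u) (b ∷ v) (inj₂ (a≡b , u<v)) = inj₂ (sym a≡b , altLtEven-flip u v u<v)

  altLtEven-flip : ∀ u v → altLtEven u v → altLtOdd v u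
  altLtEven-flip (a ∷ u) (b ∷ v) (inj₁ b<a)           = inj₁ b<a
  altLtEven-flip (a ∷ u) (b ∷ v) (inj₂ (a≡b , u<v)) = inj₂ (sym a≡b , altLtOdd-flip u v u<v)

mutual
  altLtOdd-irrefl : ∀ u → ¬ altLtOdd u u
  altLtOdd-irrefl (a ∷ u) (inj₁ a<a)      = <-irrefl refl a<a
  altLtOdd-irrefl (a ∷ u) (inj₂ (_ , u<u)) = altLtEven-irrefl u u<u

  altLtEven-irrefl : ∀ u → ¬ altLtEven u u
  altLtEven-irrefl (a ∷ u) (inj₁ a<a)      = <-irrefl refl a<a
  altLtEven-irrefl (a ∷ u) (inj₂ (_ , u<u)) = altLtOdd-irrefl u u<u

<alt-or-≡ : ∀ {u v} {S T : Set} → (S → T) → u <alt v ⊎ (u ≡ v × S) → u ≤alt v × (u ≡ v → T)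
<alt-or-≡ {u} _ (inj₁ u<v)       = inj₁ u<v , λ { refl → contradiction u<v (altLtOdd-irrefl u) }
<alt-or-≡ f (inj₂ (u≡v , s)) = inj₂ u≡v , λ _ → f s

letters : (ℕ → ℕ) → ℕ → ℕ → List ℕ
letters w i zero    = []
letters w i (suc d) = w i ∷ letters w (suc i) d

applyUpTo-letters : ∀ w i d {f} → (∀ t → f t ≡ w (i + t)) → applyUpTo f d ≡ letters w i d
applyUpTo-letters w i zero    f≗ = refl
applyUpTo-letters w i (suc d) f≗ = cong₂ _∷_
  (trans (f≗ 0) (cong w (+-identityʳ i)))
  (applyUpTo-letters w (suc i) d (λ t → trans (f≗ (suc t)) (cong w (+-suc i t))))

factor-letters : ∀ w i k → factor w i k ≡ letters w i (k ∸ i)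
factor-letters w i k = applyUpTo-letters w i (k ∸ i) (λ _ → refl)

module Counting {p : Level} {P : Pred ℕ p} (P? : Decidable P) where

  countUpTo : ℕ → ℕ
  countUpTo m = length (filter P? (applyUpTo suc m))

  countUpTo-suc : ∀ m → countUpTo (suc m) ≡ countUpTo m + length (filter P? [ suc m ])
  countUpTo-suc m = begin
    length (filter P? (applyUpTo suc (suc m)))
      ≡⟨ cong (length ∘ filter P?) (sym (applyUpTo-∷ʳ suc m)) ⟩
    length (filter P? (applyUpTo suc m ++ [ suc m ]))
      ≡⟨ cong length (filter-++ P? (applyUpTo suc m) [ suc m ]) ⟩
    length (filter P? (applyUpTo suc m) ++ filter P? [ suc m ])
      ≡⟨ length-++ (filter P? (applyUpTo suc m)) ⟩
    countUpTo m + length (filter P? [ suc m ]) ∎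
    where open ≡-Reasoning

  countUpTo-mono′ : ∀ {m m′} → m ≤′ m′ → countUpTo m ≤ countUpTo m′
  countUpTo-mono′ ≤′-refl = ≤-refl
  countUpTo-mono′ {m} (≤′-step {m′} m≤′m′) = ≤-trans (countUpTo-mono′ m≤′m′)
    (subst (countUpTo m′ ≤_) (sym (countUpTo-suc m′)) (m≤m+n (countUpTo m′) _))

  countUpTo-mono : ∀ {m m′} → m ≤ m′ → countUpTo m ≤ countUpTo m′
  countUpTo-mono = countUpTo-mono′ ∘ ≤⇒≤′

  countUpTo-strict : ∀ {k m} → P (suc k) → suc k ≤ m → countUpTo k < countUpTo m
  countUpTo-strict {k} {m} Pk k<m = begin-strict
    countUpTo k
      <⟨ m<m+n (countUpTo k) (s≤s z≤n) ⟩
    countUpTo k + 1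
      ≡⟨ cong (λ xs → countUpTo k + length xs) (filter-accept P? Pk) ⟨
    countUpTo k + length (filter P? [ suc k ])
      ≡⟨ countUpTo-suc k ⟨
    countUpTo (suc k)
      ≤⟨ countUpTo-mono k<m ⟩
    countUpTo m ∎
    where open ≤-Reasoning

module Descent (g : ℕ → ℕ) where

  stepwise-≥′ : ∀ {a b} → a ≤′ b → (∀ m → a ≤ m → m < b → g (suc m) ≤ g m) → g b ≤ g a
  stepwise-≥′ ≤′-refl _ = ≤-refl
  stepwise-≥′ (≤′-step {b} a≤′b) steps = ≤-trans (steps b (≤′⇒≤ a≤′b) ≤-refl)
    (stepwise-≥′ a≤′b (λ m a≤m m<b → steps m a≤m (m<n⇒m<1+n m<b)))

  stepwise-≥ : ∀ {a b} → a ≤ b → (∀ m → a ≤ m → m < b → g (suc m) ≤ g m) → g b ≤ g a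
  stepwise-≥ = stepwise-≥′ ∘ ≤⇒≤′

  stepwise-≥-skipping : ∀ c {a b} → a ≤ b → a ≢ c → b ≢ c →
    (∀ m → a ≤ m → m < b → m ≢ c → suc m ≢ c → g (suc m) ≤ g m) →
    (∀ m → a ≤ m → suc m ≡ c → c < b → g (suc c) ≤ g m) →
    g b ≤ g a
  stepwise-≥-skipping c {a} {b} a≤b a≢c b≢c steps jump with <-cmp c a | <-cmp c b
  ... | tri≈ _ c≡a _ | _ = contradiction (sym c≡a) a≢c
  ... | tri> _ _ _ | tri≈ _ c≡b _ = contradiction (sym c≡b) b≢c
  ... | tri< c<a _ _ | _ = stepwise-≥ a≤b λ m a≤m m<b →
    steps m a≤m m<b (>⇒≢ (<-≤-trans c<a a≤m)) (>⇒≢ (<-≤-trans c<a (m≤n⇒m≤1+n a≤m)))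
  ... | tri> _ _ _ | tri> _ _ b<c = stepwise-≥ a≤b λ m a≤m m<b →
    steps m a≤m m<b (<⇒≢ (<-trans m<b b<c)) (<⇒≢ (≤-<-trans m<b b<c))
  ... | tri> _ _ (s≤s {n = c′} a≤c′) | tri< c<b _ _ = begin
    g b             ≤⟨ stepwise-≥ c<b (λ m c<m m<b →
                         steps m (≤-trans a≤c′ (<⇒≤ (<-trans (n<1+n c′) c<m))) m<b
                               (>⇒≢ c<m) (>⇒≢ (m<n⇒m<1+n c<m))) ⟩
    g (suc c)       ≤⟨ jump c′ a≤c′ refl c<b ⟩
    g c′            ≤⟨ stepwise-≥ a≤c′ (λ m a≤m m<c′ →
                         steps m a≤m (<-trans (<-trans m<c′ (n<1+n c′)) c<b)
                               (<⇒≢ (m<n⇒m<1+n m<c′)) (<⇒≢ (s≤s m<c′))) ⟩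
    g a             ∎
    where open ≤-Reasoning

module OneBased {n : ℕ} (π : Permutation′ n) where

  perm-suc : ∀ k (k<n : suc k ≤ n) → perm π (suc k) ≡ suc (toℕ (π ⟨$⟩ʳ fromℕ< k<n))
  perm-suc k k<n with suc k ≤? n
  ... | yes _   = refl
  ... | no k≮n = contradiction k<n k≮n

  permInv-suc : ∀ k (k<n : suc k ≤ n) → permInv π (suc k) ≡ suc (toℕ (π ⟨$⟩ˡ fromℕ< k<n))
  permInv-suc k k<n with suc k ≤? n
  ... | yes _   = refl
  ... | no k≮n = contradiction k<n k≮n

  perm-positive : ∀ {x} → 1 ≤ x → x ≤ n → 1 ≤ perm π x
  perm-positive {suc k} _ x≤n rewrite perm-suc k x≤n = s≤s z≤n

  perm-≤ : ∀ {x} → 1 ≤ x → x ≤ n → perm π x ≤ n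
  perm-≤ {suc k} _ x≤n rewrite perm-suc k x≤n = toℕ<n _

  permInv-perm : ∀ {x} → 1 ≤ x → x ≤ n → permInv π (perm π x) ≡ x
  permInv-perm {suc k} _ x≤n
    rewrite perm-suc k x≤n
          | permInv-suc (toℕ (π ⟨$⟩ʳ fromℕ< x≤n)) (toℕ<n _)
          | fromℕ<-toℕ (π ⟨$⟩ʳ fromℕ< x≤n) (toℕ<n (π ⟨$⟩ʳ fromℕ< x≤n))
          | inverseˡ π {fromℕ< x≤n}
          = cong suc (toℕ-fromℕ< x≤n)

  perm-injective : ∀ {x y} → 1 ≤ x → x ≤ n → 1 ≤ y → y ≤ n → perm π x ≡ perm π y → x ≡ y
  perm-injective {x} {y} 1≤x x≤n 1≤y y≤n πx≡πy = begin
    x                     ≡⟨ sym (permInv-perm 1≤x x≤n) ⟩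
    permInv π (perm π x)  ≡⟨ cong (permInv π) πx≡πy ⟩
    permInv π (perm π y)  ≡⟨ permInv-perm 1≤y y≤n ⟩
    y                     ∎
    where open ≡-Reasoning

module Successors {n : ℕ} (π : Permutation′ n) where
  open OneBased π

  π∘suc∘π⁻¹ : ℕ → ℕ
  π∘suc∘π⁻¹ k = perm π (permInv π k + 1)

  π∘suc∘π⁻¹-perm : ∀ {x} → 1 ≤ x → x ≤ n → π∘suc∘π⁻¹ (perm π x) ≡ perm π (suc x)
  π∘suc∘π⁻¹-perm {x} 1≤x x≤n =
    trans (cong (λ y → perm π (y + 1)) (permInv-perm 1≤x x≤n)) (cong (perm π) (+-comm x 1))

  -- A value k failing zCond is one where π∘suc∘π⁻¹ does not increase from k to k + 1;
  -- at k + 1 = π(n), where π∘suc∘π⁻¹ is junk, the second clause of zCond instead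
  -- compares its values at k and k + 2.
  zCond-free⇒successors-reversed : ∀ {a b} → 1 ≤ a → a < n → 1 ≤ b → b < n → a ≢ b →
    perm π a < perm π b → (∀ k → perm π a ≤ k → k < perm π b → ¬ zCond π k) →
    perm π (suc b) < perm π (suc a)
  zCond-free⇒successors-reversed {a} {b} 1≤a a<n 1≤b b<n a≢b πa<πb zCond-free =
    ≤∧≢⇒< (subst₂ _≤_ (π∘suc∘π⁻¹-perm 1≤b (<⇒≤ b<n)) (π∘suc∘π⁻¹-perm 1≤a (<⇒≤ a<n)) descent)
          (a≢b ∘ sym ∘ suc-injective ∘ perm-injective (s≤s z≤n) b<n (s≤s z≤n) a<n)
    where
      open Descent π∘suc∘π⁻¹
      c : ℕ
      c = perm π n

      ≢last : ∀ {x} → 1 ≤ x → x < n → perm π x ≢ c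
      ≢last 1≤x x<n πx≡c =
        <⇒≢ x<n (perm-injective 1≤x (<⇒≤ x<n) (≤-trans 1≤x (<⇒≤ x<n)) ≤-refl πx≡c)

      step : ∀ m → perm π a ≤ m → m < perm π b → m ≢ c → suc m ≢ c →
             π∘suc∘π⁻¹ (suc m) ≤ π∘suc∘π⁻¹ m
      step m a≤m m<b m≢c 1+m≢c = ≮⇒≥ λ ascent → zCond-free m a≤m m<b
        (inj₁ ((m≢c , λ c≡m+1 → 1+m≢c (trans (+-comm 1 m) (sym c≡m+1)))
              , subst (λ y → π∘suc∘π⁻¹ m < π∘suc∘π⁻¹ y) (+-comm 1 m) ascent))

      jump : ∀ m → perm π a ≤ m → suc m ≡ c → c < perm π b → π∘suc∘π⁻¹ (suc c) ≤ π∘suc∘π⁻¹ m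
      jump m a≤m 1+m≡c c<b = ≮⇒≥ λ ascent →
        zCond-free m a≤m (<-trans (n<1+n m) (subst (_< perm π b) (sym 1+m≡c) c<b))
        (inj₂ ((trans (+-comm m 1) 1+m≡c , <⇒≢ (<-≤-trans c<b (perm-≤ 1≤b (<⇒≤ b<n))))
              , subst₂ (λ x y → π∘suc∘π⁻¹ x < π∘suc∘π⁻¹ y) (cong (_∸ 1) 1+m≡c) (+-comm 1 c) ascent))

      descent : π∘suc∘π⁻¹ (perm π b) ≤ π∘suc∘π⁻¹ (perm π a)
      descent = stepwise-≥-skipping c (<⇒≤ πa<πb) (≢last 1≤a a<n) (≢last 1≤b b<n) step jump

module Comparison (n : ℕ) (π : Permutation′ n) (w : ℕ → ℕ)
  (slack : ∀ i j → 1 ≤ i → i < n → 1 ≤ j → j < n → perm π i < perm π j →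
    (+ z π j) - (+ z π i) ≤ℤ (+ w j) - (+ w i)) where
  open OneBased π
  open Successors π
  open Counting (zCond? π)

  z-mono : ∀ {a b} → perm π a ≤ perm π b → z π a ≤ z π b
  z-mono = countUpTo-mono ∘ ∸-monoˡ-≤ 1

  z-strict : ∀ {a b k} → 1 ≤ perm π a → perm π a ≤ k → k < perm π b → zCond π k → z π a < z π b
  z-strict {k = zero}  1≤πa πa≤0 _ _ = contradiction (≤-trans 1≤πa πa≤0) λ ()
  z-strict {k = suc k} _ πa≤k k<πb zk =
    ≤-<-trans (countUpTo-mono (∸-monoˡ-≤ 1 πa≤k)) (countUpTo-strict zk (∸-monoˡ-≤ 1 k<πb))

  letter-tie : ∀ {a b} → 1 ≤ a → a < n → 1 ≤ b → b < n → perm π a < perm π b → ¬ w a < w b →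
    w a ≡ w b × (∀ k → perm π a ≤ k → k < perm π b → ¬ zCond π k)
  letter-tie {a} {b} 1≤a a<n 1≤b b<n πa<πb wa≮wb =
      ≤-antisym (gap-≤ (z-mono {a} {b} (<⇒≤ πa<πb)) gap) (≮⇒≥ wa≮wb)
    , λ k πa≤k k<πb zk →
        wa≮wb (gap-< (z-strict {a} {b} (perm-positive 1≤a (<⇒≤ a<n)) πa≤k k<πb zk) gap)
    where
      gap : + z π b - + z π a ≤ℤ + w b - + w a
      gap = slack a b 1≤a a<n 1≤b b<n πa<πb

  Compared : ℕ → ℕ → ℕ → Set
  Compared d a b = letters w a d <alt letters w b d
    ⊎ (letters w a d ≡ letters w b d × SignedLt d (perm π (a + d)) (perm π (b + d)))

  compare-letters : ∀ d {a b} → 1 ≤ a → 1 ≤ b → a ≢ b → a + d ≤ n → b + d ≤ n →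
    perm π a < perm π b → Compared d a b
  compare-letters zero {a} {b} _ _ _ _ _ πa<πb = inj₂ (refl ,
    subst₂ (λ x y → perm π x < perm π y) (sym (+-identityʳ a)) (sym (+-identityʳ b)) πa<πb)
  compare-letters (suc d) {a} {b} 1≤a 1≤b a≢b a+d≤n b+d≤n πa<πb = extend (w a <? w b)
    where
      1+a+d≤n : suc a + d ≤ n
      1+a+d≤n = subst (_≤ n) (+-suc a d) a+d≤n
      1+b+d≤n : suc b + d ≤ n
      1+b+d≤n = subst (_≤ n) (+-suc b d) b+d≤n
      a<n : a < n
      a<n = m+n≤o⇒m≤o (suc a) 1+a+d≤n
      b<n : b < n
      b<n = m+n≤o⇒m≤o (suc b) 1+b+d≤n

      extend : Dec (w a < w b) → Compared (suc d) a b
      extend (yes wa<wb) = inj₁ (inj₁ wa<wb)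
      extend (no wa≮wb) with letter-tie 1≤a a<n 1≤b b<n πa<πb wa≮wb
      ... | wa≡wb , zCond-free
          with compare-letters d (s≤s z≤n) (s≤s z≤n) (a≢b ∘ sym ∘ suc-injective) 1+b+d≤n 1+a+d≤n
                 (zCond-free⇒successors-reversed 1≤a a<n 1≤b b<n a≢b πa<πb zCond-free)
      ... | inj₁ rest<       = inj₁ (inj₂ (wa≡wb , altLtOdd-flip _ _ rest<))
      ... | inj₂ (rest≡ , s) = inj₂ (cong₂ _∷_ wa≡wb (sym rest≡) ,
        subst₂ (SignedLt d) (cong (perm π) (sym (+-suc b d))) (cong (perm π) (sym (+-suc a d))) s)

lemma2 : (n : ℕ) (π : Permutation′ n) (w : ℕ → ℕ) →
    (∀ i j → 1 ≤ i → i < n → 1 ≤ j → j < n → perm π i < perm π j →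
      (+ z π j) - (+ z π i) ≤ℤ (+ w j) - (+ w i)) →
    ∀ i j → 1 ≤ i → i < j → j < n →
      ((perm π i < perm π j →
          (factor w i (i + (n ∸ j)) ≤alt factor w j n)
          × (factor w i (i + (n ∸ j)) ≡ factor w j n →
              ((- (+ 1)) ^ (n ∸ j)) * (+ perm π (i + (n ∸ j)))
                <ℤ ((- (+ 1)) ^ (n ∸ j)) * (+ perm π n)))
      × (perm π j < perm π i →
          (factor w j n ≤alt factor w i (i + (n ∸ j)))
          × (factor w i (i + (n ∸ j)) ≡ factor w j n →
              ((- (+ 1)) ^ (n ∸ j)) * (+ perm π n)
                <ℤ ((- (+ 1)) ^ (n ∸ j)) * (+ perm π (i + (n ∸ j))))))
lemma2 n π w slack i j 1≤i i<j j<n = forward , backward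
  where
    open Comparison n π w slack

    d : ℕ
    d = n ∸ j

    j+d≡n : j + d ≡ n
    j+d≡n = m+[n∸m]≡n (<⇒≤ j<n)

    i+d≤n : i + d ≤ n
    i+d≤n = ≤-trans (+-monoˡ-≤ d (<⇒≤ i<j)) (≤-reflexive j+d≡n)

    1≤j : 1 ≤ j
    1≤j = ≤-trans 1≤i (<⇒≤ i<j)

    factorᵢ : factor w i (i + d) ≡ letters w i d
    factorᵢ = trans (factor-letters w i (i + d)) (cong (letters w i) (m+n∸m≡n i d))

    factorⱼ : factor w j n ≡ letters w j d
    factorⱼ = factor-letters w j n

    πlast : perm π (j + d) ≡ perm π n
    πlast = cong (perm π) j+d≡n

    forward : perm π i < perm π j →
      factor w i (i + d) ≤alt factor w j n
        × (factor w i (i + d) ≡ factor w j n →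
           (- + 1) ^ d * + perm π (i + d) <ℤ (- + 1) ^ d * + perm π n)
    forward πi<πj rewrite factorᵢ | factorⱼ =
      <alt-or-≡ (SignedLt⇒<ℤ d ∘ subst (SignedLt d (perm π (i + d))) πlast)
        (compare-letters d 1≤i 1≤j (<⇒≢ i<j) i+d≤n (≤-reflexive j+d≡n) πi<πj)

    backward : perm π j < perm π i →
      factor w j n ≤alt factor w i (i + d)
        × (factor w i (i + d) ≡ factor w j n →
           (- + 1) ^ d * + perm π n <ℤ (- + 1) ^ d * + perm π (i + d))
    backward πj<πi rewrite factorᵢ | factorⱼ =
      map₂ (_∘ sym) (<alt-or-≡ (SignedLt⇒<ℤ d ∘ subst (λ x → SignedLt d x (perm π (i + d))) πlast)
        (compare-letters d 1≤j 1≤i (>⇒≢ i<j) (≤-reflexive j+d≡n) i+d≤n πj<πi))
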